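{- Let $G=(V,E)$ be an unweighted undirected graph. Let $c$ be the clustering returned by \textsc{Pivot} on $G$, and let $E_W=\{(i,j)\in E: c[i]\neq c[j]\}$ and $E_N=\{\{i,j\}\in\binom{V}{2}\setminus E: c[i]=c[j]\}$. Then $(E_W,E_N)$ is an STC+ labeling of $G$ and $\mathbb{E}[|E_W|+|E_N|]$ is at most $3$ times the optimal value of \textsc{MinSTC+} on $G$. Equivalently, the set $\{v_{ij}:\{i,j\}\in E_W\cup E_N\}$ is a vertex cover of the open wedge hypergraph of $G$ whose expected size is at most $3$ times the minimum size of a vertex cover of that hypergraph.
   Context: An open wedge in $G$ is a set of three nodes $\{u,v,w\}$ whose induced subgraph has exactly two edges; if the edges are $(u,v),(u,w)$ it is centered at $u$. An STC+ labeling of $G$ is a pair $(E_W,E_N)$ with $E_W\subseteq E$ (edges labeled weak) and $E_N\subseteq\binom{V}{2}\setminus E$ (non-adjacent pairs turned into new weak edges) such that for every open wedge $\{u,v,w\}$ centered at $u$, either $(u,v)\in E_W$, or $(u,w)\in E_W$, or $\{v,w\}\in E_N$. \textsc{MinSTC+} is the problem of finding an STC+ labeling minimizing $|E_W|+|E_N|$. The open wedge hypergraph of $G$ is the 3-uniform hypergraph with a vertex $v_{ij}$ for each pair $\{i,j\}\in\binom{V}{2}$ and a hyperedge $\{v_{ij},v_{ik},v_{jk}\}$ for each open wedge $\{i,j,k\}$ of $G$; a vertex cover of a hypergraph is a vertex set meeting every hyperedge. \textsc{Pivot}$(G)$: let $\mathcal{U}=V$ be the unclustered nodes and $\mathit{clus}=1$;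 generate a uniformly random permutation of $V$; for each node $v$ in this order, if $v\in\mathcal{U}$, assign $c[v]=\mathit{clus}$ and $c[u]=\mathit{clus}$ for every neighbor $u$ of $v$ in $\mathcal{U}$, remove $v$ and these neighbors from $\mathcal{U}$, and increment $\mathit{clus}$. Return the cluster assignment $c$. -}

module Defs where

open import Data.Bool using (Bool; true; false; _∧_; _∨_; not; if_then_else_; T)
open import Data.Nat using (ℕ; zero; suc; _+_; _*_; _<ᵇ_; _≡ᵇ_)
open import Data.Fin using (Fin; toℕ)
open import Data.Fin.Properties using () renaming (_≟_ to _≟F_)
open import Data.List using (List; []; _∷_; [_]; map; concatMap; length; filterᵇ; foldr)
open import Data.Nat.ListAction using (sum)
open import Data.List using (allFin) public
open import Data.Maybe using (Maybe; just; nothing)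
open import Data.Product using (_×_; _,_)
open import Relation.Nullary using (¬_; does)
open import Relation.Binary.PropositionalEquality using (_≡_)

record Graph (n : ℕ) : Set where
  field
    adj    : Fin n → Fin n → Bool
    sym    : ∀ i j → adj i j ≡ adj j i
    irrefl : ∀ i → adj i i ≡ false
open Graph public

-- A candidate labeling: characteristic functions of E_W and E_N
-- (sets of unordered pairs, represented as symmetric relations).
record Labeling (n : ℕ) : Set where
  field
    weak : Fin n → Fin n → Bool
    new  : Fin n → Fin n → Bool
open Labeling public

record IsSTC+ {n : ℕ} (G : Graph n) (L : Labeling n) : Set where
  field
    weak-sym   : ∀ i j → weak L i j ≡ weak L j i
    new-sym    : ∀ i j → new L i j ≡ new L j i
    weak⊆E     : ∀ i j → weak L i j ≡ true → adj G i j ≡ true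
    new⊆nonE   : ∀ i j → new L i j ≡ true → adj G i j ≡ false
    new-irrefl : ∀ i → new L i i ≡ false
    wedge : ∀ u v w → ¬ (v ≡ w) →
            adj G u v ≡ true → adj G u w ≡ true → adj G v w ≡ false →
            (weak L u v ∨ weak L u w ∨ new L v w) ≡ true

pairs : (n : ℕ) → List (Fin n × Fin n)
pairs n = concatMap (λ i → concatMap (λ j → if toℕ i <ᵇ toℕ j then [ (i , j) ] else [])
                                      (allFin n))
                    (allFin n)

countPairs : {n : ℕ} → (Fin n → Fin n → Bool) → ℕ
countPairs {n} r = length (filterᵇ (λ p → r (Data.Product.proj₁ p) (Data.Product.proj₂ p)) (pairs n))

cost : {n : ℕ} → Labeling n → ℕ
cost L = countPairs (weak L) + countPairs (new L)

-- all permutations of a list (each permutation exactly once)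
insertions : {A : Set} → A → List A → List (List A)
insertions x []       = [ x ∷ [] ]
insertions x (y ∷ ys) = (x ∷ y ∷ ys) ∷ map (y ∷_) (insertions x ys)

perms : {A : Set} → List A → List (List A)
perms []       = [ [] ]
perms (x ∷ xs) = concatMap (insertions x) (perms xs)

-- The orderings of V = Fin n; Pivot draws one uniformly at random.
orderings : (n : ℕ) → List (List (Fin n))
orderings n = perms (allFin n)

-- Pivot, run deterministically along a given ordering.
-- State: cluster assignment (nothing = still in U) and the counter clus.
isNothing : Maybe ℕ → Bool
isNothing nothing  = true
isNothing (just _) = false

pivotStep : {n : ℕ} → Graph n → Fin n → (Fin n → Maybe ℕ) × ℕ → (Fin n → Maybe ℕ) × ℕ
pivotStep G v (c , clus) with c v
... | just _  = (c , clus)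
... | nothing = ((λ u → if (does (u ≟F v) ∨ adj G v u) ∧ isNothing (c u)
                          then just clus else c u) , suc clus)

pivotRun : {n : ℕ} → Graph n → List (Fin n) → (Fin n → Maybe ℕ) × ℕ → (Fin n → Maybe ℕ) × ℕ
pivotRun G []       s = s
pivotRun G (v ∷ vs) s = pivotRun G vs (pivotStep G v s)

pivot : {n : ℕ} → Graph n → List (Fin n) → Fin n → Maybe ℕ
pivot G order = Data.Product.proj₁ (pivotRun G order ((λ _ → nothing) , 1))

sameCluster : Maybe ℕ → Maybe ℕ → Bool
sameCluster (just a) (just b) = a ≡ᵇ b
sameCluster nothing  nothing  = true
sameCluster _        _        = false

pivotLabeling : {n : ℕ} → Graph n → List (Fin n) → Labeling n
pivotLabeling G order = record
  { weak = λ i j → adj G i j ∧ not (sameCluster (c i) (c j))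
  ; new  = λ i j → not (adj G i j) ∧ not (does (i ≟F j)) ∧ sameCluster (c i) (c j)
  }
  where c = pivot G order

-- Σ over all orderings of the cost of Pivot's labeling
-- (= (number of orderings) × expected cost under a uniform random permutation)
totalPivotCost : {n : ℕ} → Graph n → ℕ
totalPivotCost {n} G = sum (map (λ σ → cost (pivotLabeling G σ)) (orderings n))

-- Pivot's labeling consists of the pairs on which its clustering disagrees with G, and since
-- "same cluster" is transitive every open wedge is covered.  The bound is the charging argument
-- of Ailon, Charikar and Newman.  In a run, a pair {y,z} is decided by the first pivot v that
-- touches it: before that step y and z are unclustered, after it they share a cluster iff v
-- touches both.  So {y,z} ends up in E_W ∪ E_N iff {v,y,z} is an open wedge all of whose
-- vertices were unclustered when v came up, and the mistake is charged to that wedge.  The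
-- number w(k,y,z) of orderings charging {y,z} to the wedge through k is symmetric in k, y, z
-- (relabel the orderings by a transposition), and for a fixed pair these numbers add up to at
-- most the number N of orderings.  An STC+ labeling L pays at least 1 on the three pairs of every
-- open wedge, so, summing over ordered pairs and triples,
--   2 Σ_σ cost(σ) = Σ w(k,y,z) ≤ Σ w(k,y,z) (c_L(y,z) + c_L(k,y) + c_L(k,z))
--                 = 3 Σ_{y,z} c_L(y,z) Σ_k w(k,y,z) ≤ 3 N · 2 cost(L).

module Submission where

open import Algebra.Bundles using (CommutativeMonoid)
open import Data.Bool using (Bool; true; false; _∧_; _∨_; not; _xor_; if_then_else_; T)
open import Data.Bool.Properties
  using ( ∧-zeroʳ; ∧-identityʳ; ∧-comm; ∧-conicalˡ; ∧-conicalʳ; ∨-conicalˡ; ∨-conicalʳ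
        ; not-involutive; xor-same; ∧-commutativeMonoid )
open import Data.Fin using (Fin; toℕ)
open import Data.Fin.Permutation
  using (Permutation; _⟨$⟩ʳ_; _⟨$⟩ˡ_; inverseˡ; inverseʳ; transpose)
import Data.Fin.Permutation.Components as Transposition
open import Data.Fin.Properties using (toℕ-injective) renaming (_≟_ to _≟F_)
open import Data.List
  using (List; []; _∷_; [_]; _++_; map; concatMap; length; allFin; filterᵇ)
open import Data.List.Membership.Propositional using (_∈_; find)
open import Data.List.Membership.Propositional.Properties
  using (∈-map⁺; ∈-map⁻; ∈-concatMap⁻; ∈-allFin)
open import Data.List.Membership.Propositional.Properties.WithK using (unique∧set⇒bag)
open import Data.List.Relation.Binary.BagAndSetEquality using (∼bag⇒↭)
open import Data.List.Relation.Binary.Permutation.Propositional as Perm using (_↭_)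
open import Data.List.Relation.Binary.Subset.Propositional using (_⊆_)
open import Data.List.Relation.Unary.All.Properties using (All¬⇒¬Any)
open import Data.List.Relation.Unary.AllPairs using (_∷_)
open import Data.List.Relation.Unary.Any as Any using (here; there)
open import Data.List.Relation.Unary.Unique.Propositional using (Unique)
import Data.List.Relation.Unary.Unique.Propositional.Properties as Unique
open import Data.Maybe using (Maybe; just; nothing)
open import Data.Nat using (ℕ; suc; _+_; _*_; _≤_; _<_; _≡ᵇ_; _<ᵇ_; z≤n; s≤s)
import Data.Nat as ℕ
open import Data.Nat.ListAction using (sum)
open import Data.Nat.Properties
open import Data.Nat.Solver using (module +-*-Solver)
open import Data.Product using (_×_; _,_; proj₁; proj₂; ∃)
open import Data.Sum using (_⊎_; inj₁; inj₂)
open import Function using (_∘_)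
open import Function.Bundles using (mk⇔)
open import Relation.Binary.Definitions using (DecidableEquality; tri<; tri≈; tri>)
open import Relation.Binary.PropositionalEquality hiding ([_])
open import Relation.Nullary using (¬_; Dec; does; yes; no; contradiction)
open import Relation.Nullary.Decidable using (dec-true; dec-false)

open import Defs hiding (sym)

open import Algebra.Properties.CommutativeSemigroup +-commutativeSemigroup
  using (interchange; x∙yz≈y∙xz; xy∙z≈zx∙y; xy∙z≈yx∙z; xy∙z≈yz∙x)
open import Algebra.Properties.CommutativeSemigroup
  (CommutativeMonoid.commutativeSemigroup ∧-commutativeMonoid)
  using () renaming (x∙yz≈y∙xz to ∧-x∙yz≈y∙xz)

-- Finite sums

∑ : {A : Set} → List A → (A → ℕ) → ℕ
∑ xs f = sum (map f xs)

syntax ∑ xs (λ x → e) = ∑[ x ← xs ] e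

module _ {A : Set} where

  ∑-++ : (xs ys : List A) (f : A → ℕ) → ∑ (xs ++ ys) f ≡ ∑ xs f + ∑ ys f
  ∑-++ [] ys f = refl
  ∑-++ (x ∷ xs) ys f = trans (cong (f x +_) (∑-++ xs ys f)) (sym (+-assoc (f x) _ _))

  ∑-cong : (xs : List A) {f g : A → ℕ} → (∀ x → x ∈ xs → f x ≡ g x) →
           ∑ xs f ≡ ∑ xs g
  ∑-cong [] eq = refl
  ∑-cong (x ∷ xs) eq = cong₂ _+_ (eq x (here refl)) (∑-cong xs (λ y y∈ → eq y (there y∈)))

  ∑-mono : (xs : List A) {f g : A → ℕ} → (∀ x → f x ≤ g x) → ∑ xs f ≤ ∑ xs g
  ∑-mono [] le = z≤n
  ∑-mono (x ∷ xs) le = +-mono-≤ (le x) (∑-mono xs le)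

  ∑-+ : (xs : List A) (f g : A → ℕ) → ∑[ x ← xs ] (f x + g x) ≡ ∑ xs f + ∑ xs g
  ∑-+ [] f g = refl
  ∑-+ (x ∷ xs) f g = trans (cong (f x + g x +_) (∑-+ xs f g)) (interchange (f x) (g x) _ _)

  ∑-*ˡ : (xs : List A) (c : ℕ) (f : A → ℕ) → ∑[ x ← xs ] (c * f x) ≡ c * ∑ xs f
  ∑-*ˡ [] c f = sym (*-zeroʳ c)
  ∑-*ˡ (x ∷ xs) c f = trans (cong (c * f x +_) (∑-*ˡ xs c f)) (sym (*-distribˡ-+ c (f x) _))

  ∑-const : (xs : List A) (c : ℕ) → ∑[ _ ← xs ] c ≡ length xs * c
  ∑-const [] c = refl
  ∑-const (x ∷ xs) c = cong (c +_) (∑-const xs c)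

  ∑-zero : (xs : List A) {f : A → ℕ} → (∀ x → x ∈ xs → f x ≡ 0) → ∑ xs f ≡ 0
  ∑-zero xs f≡0 = trans (∑-cong xs f≡0) (trans (∑-const xs 0) (*-zeroʳ (length xs)))

  ∑-eq-single : (xs : List A) (v : A) (f : A → ℕ) → Unique xs → v ∈ xs →
                (∀ x → ¬ x ≡ v → f x ≡ 0) → ∑ xs f ≡ f v
  ∑-eq-single (x ∷ xs) v f (x∉xs ∷ _) (here refl) f≡0 =
    trans (cong (f x +_) (∑-zero xs (λ y y∈ → f≡0 y (λ { refl → All¬⇒¬Any x∉xs y∈ }))))
          (+-identityʳ (f x))
  ∑-eq-single (x ∷ xs) v f (x∉xs ∷ xs!) (there v∈) f≡0 =
    trans (cong (_+ ∑ xs f) (f≡0 x (λ { refl → All¬⇒¬Any x∉xs v∈ })))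
          (∑-eq-single xs v f xs! v∈ f≡0)

module _ {A B : Set} where

  ∑-map : (g : A → B) (xs : List A) (f : B → ℕ) → ∑ (map g xs) f ≡ ∑ xs (f ∘ g)
  ∑-map g [] f = refl
  ∑-map g (x ∷ xs) f = cong (f (g x) +_) (∑-map g xs f)

  ∑-concatMap : (g : A → List B) (xs : List A) (f : B → ℕ) →
                ∑ (concatMap g xs) f ≡ ∑[ x ← xs ] ∑ (g x) f
  ∑-concatMap g [] f = refl
  ∑-concatMap g (x ∷ xs) f =
    trans (∑-++ (g x) (concatMap g xs) f) (cong (∑ (g x) f +_) (∑-concatMap g xs f))

  ∑-comm : (xs : List A) (ys : List B) (f : A → B → ℕ) →
           ∑[ x ← xs ] ∑[ y ← ys ] f x y ≡ ∑[ y ← ys ] ∑[ x ← xs ] f x y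
  ∑-comm [] ys f = sym (∑-zero ys (λ _ _ → refl))
  ∑-comm (x ∷ xs) ys f = trans (cong (∑ ys (f x) +_) (∑-comm xs ys f)) (sym (∑-+ ys (f x) _))

∑³ : {A : Set} → List A → (A → A → A → ℕ) → ℕ
∑³ xs f = ∑[ x ← xs ] ∑[ y ← xs ] ∑[ z ← xs ] f x y z

module _ {A : Set} (xs : List A) where

  ∑³-cong : {f g : A → A → A → ℕ} → (∀ x y z → f x y z ≡ g x y z) →
            ∑³ xs f ≡ ∑³ xs g
  ∑³-cong eq = ∑-cong xs (λ x _ → ∑-cong xs (λ y _ → ∑-cong xs (λ z _ → eq x y z)))

  ∑³-mono : {f g : A → A → A → ℕ} → (∀ x y z → f x y z ≤ g x y z) →
            ∑³ xs f ≤ ∑³ xs g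
  ∑³-mono le = ∑-mono xs (λ x → ∑-mono xs (λ y → ∑-mono xs (λ z → le x y z)))

  ∑³-+ : (f g : A → A → A → ℕ) →
         ∑³ xs (λ x y z → f x y z + g x y z) ≡ ∑³ xs f + ∑³ xs g
  ∑³-+ f g = trans (∑-cong xs (λ x _ → trans (∑-cong xs (λ y _ → ∑-+ xs (f x y) (g x y)))
                                             (∑-+ xs _ _)))
                   (∑-+ xs _ _)

  ∑³-rotate : (f : A → A → A → ℕ) → ∑³ xs (λ x y z → f z x y) ≡ ∑³ xs f
  ∑³-rotate f = trans (∑-cong xs (λ x _ → ∑-comm xs xs (λ y z → f z x y)))
                      (∑-comm xs xs (λ x z → ∑[ y ← xs ] f z x y))

  ∑³-reverse : (f : A → A → A → ℕ) → ∑³ xs (λ x y z → f z y x) ≡ ∑³ xs f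
  ∑³-reverse f = trans (∑-comm xs xs (λ x y → ∑[ z ← xs ] f z y x))
    (trans (∑-cong xs (λ y _ → ∑-comm xs xs (λ x z → f z y x)))
           (∑-comm xs xs (λ y z → ∑[ x ← xs ] f z y x)))

-- Sums over all orderings

∑-insertions-∷ : {A : Set} (x z : A) (zs : List A) (g : List A → ℕ) →
  ∑ (insertions x (z ∷ zs)) g ≡ g (x ∷ z ∷ zs) + ∑[ r ← insertions x zs ] g (z ∷ r)
∑-insertions-∷ x z zs g = cong (g (x ∷ z ∷ zs) +_) (∑-map (z ∷_) (insertions x zs) g)

module _ {A : Set} where

  ∑∑-insertions-∷ : (x y z : A) (zs : List A) (g : List A → ℕ) →
    ∑[ q ← insertions y (z ∷ zs) ] ∑ (insertions x q) g ≡
      (g (x ∷ y ∷ z ∷ zs) + g (y ∷ x ∷ z ∷ zs))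
      + (∑[ r ← insertions x zs ] g (y ∷ z ∷ r) + ∑[ q ← insertions y zs ] g (x ∷ z ∷ q))
      + ∑[ q ← insertions y zs ] ∑[ r ← insertions x q ] g (z ∷ r)
  ∑∑-insertions-∷ x y z zs g = begin
    ∑[ q ← insertions y (z ∷ zs) ] ∑ (insertions x q) g
      ≡⟨ ∑-insertions-∷ y z zs _ ⟩
    ∑ (insertions x (y ∷ z ∷ zs)) g + ∑[ q ← insertions y zs ] ∑ (insertions x (z ∷ q)) g
      ≡⟨ cong₂ _+_ (trans (∑-insertions-∷ x y (z ∷ zs) g)
                          (cong (g (x ∷ y ∷ z ∷ zs) +_) (∑-insertions-∷ x z zs (g ∘ (y ∷_)))))
                   (trans (∑-cong (insertions y zs) (λ q _ → ∑-insertions-∷ x z q g))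
                          (∑-+ (insertions y zs) _ _)) ⟩
    g (x ∷ y ∷ z ∷ zs) + (g (y ∷ x ∷ z ∷ zs) + a) + (b + c)
      ≡⟨ solve 5 (λ p q a b c → p :+ (q :+ a) :+ (b :+ c) := p :+ q :+ (a :+ b) :+ c)
               refl (g (x ∷ y ∷ z ∷ zs)) (g (y ∷ x ∷ z ∷ zs)) a b c ⟩
    g (x ∷ y ∷ z ∷ zs) + g (y ∷ x ∷ z ∷ zs) + (a + b) + c ∎
    where
    open ≡-Reasoning
    open +-*-Solver
    a = ∑[ r ← insertions x zs ] g (y ∷ z ∷ r)
    b = ∑[ q ← insertions y zs ] g (x ∷ z ∷ q)
    c = ∑[ q ← insertions y zs ] ∑[ r ← insertions x q ] g (z ∷ r)

  ∑∑-insertions-comm : (x y : A) (p : List A) (g : List A → ℕ) →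
    ∑[ q ← insertions y p ] ∑ (insertions x q) g ≡ ∑[ q ← insertions x p ] ∑ (insertions y q) g
  ∑∑-insertions-comm x y [] g = cong (_+ 0) (x∙yz≈y∙xz (g (x ∷ y ∷ [])) (g (y ∷ x ∷ [])) 0)
  ∑∑-insertions-comm x y (z ∷ zs) g = begin
    ∑[ q ← insertions y (z ∷ zs) ] ∑ (insertions x q) g
      ≡⟨ ∑∑-insertions-∷ x y z zs g ⟩
    _ ≡⟨ cong₂ _+_ (cong₂ _+_ (+-comm (g (x ∷ y ∷ z ∷ zs)) _)
                              (+-comm _ (∑[ q ← insertions y zs ] g (x ∷ z ∷ q))))
                   (∑∑-insertions-comm x y zs (g ∘ (z ∷_))) ⟩
    _ ≡⟨ ∑∑-insertions-∷ y x z zs g ⟨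
    ∑[ q ← insertions x (z ∷ zs) ] ∑ (insertions y q) g ∎
    where open ≡-Reasoning

  ∑-perms-↭ : {l l′ : List A} → l ↭ l′ → (g : List A → ℕ) →
              ∑ (perms l) g ≡ ∑ (perms l′) g
  ∑-perms-↭ Perm.refl g = refl
  ∑-perms-↭ (Perm.prep {xs = l} {ys = l′} x l↭l′) g = begin
    ∑ (perms (x ∷ l)) g                        ≡⟨ ∑-concatMap (insertions x) (perms l) g ⟩
    ∑[ q ← perms l ] ∑ (insertions x q) g      ≡⟨ ∑-perms-↭ l↭l′ _ ⟩
    ∑[ q ← perms l′ ] ∑ (insertions x q) g     ≡⟨ ∑-concatMap (insertions x) (perms l′) g ⟨
    ∑ (perms (x ∷ l′)) g                       ∎
    where open ≡-Reasoning
  ∑-perms-↭ (Perm.swap {xs = l} {ys = l′} x y l↭l′) g = begin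
    ∑ (perms (x ∷ y ∷ l)) g
      ≡⟨ trans (∑-concatMap (insertions x) (perms (y ∷ l)) g)
               (∑-concatMap (insertions y) (perms l) _) ⟩
    ∑[ p ← perms l ] ∑[ q ← insertions y p ] ∑ (insertions x q) g
      ≡⟨ ∑-perms-↭ l↭l′ _ ⟩
    ∑[ p ← perms l′ ] ∑[ q ← insertions y p ] ∑ (insertions x q) g
      ≡⟨ ∑-cong (perms l′) (λ p _ → ∑∑-insertions-comm x y p g) ⟩
    ∑[ p ← perms l′ ] ∑[ q ← insertions x p ] ∑ (insertions y q) g
      ≡⟨ trans (∑-concatMap (insertions y) (perms (x ∷ l′)) g)
               (∑-concatMap (insertions x) (perms l′) _) ⟨
    ∑ (perms (y ∷ x ∷ l′)) g ∎
    where open ≡-Reasoning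
  ∑-perms-↭ (Perm.trans l↭l′ l′↭l″) g =
    trans (∑-perms-↭ l↭l′ g) (∑-perms-↭ l′↭l″ g)

  ∑-insertions-map : {B : Set} (f : A → B) (x : A) (p : List A) (g : List B → ℕ) →
    ∑ (insertions (f x) (map f p)) g ≡ ∑[ σ ← insertions x p ] g (map f σ)
  ∑-insertions-map f x [] g = refl
  ∑-insertions-map f x (z ∷ zs) g = begin
    ∑ (insertions (f x) (f z ∷ map f zs)) g
      ≡⟨ ∑-insertions-∷ (f x) (f z) (map f zs) g ⟩
    g (f x ∷ f z ∷ map f zs) + ∑[ r ← insertions (f x) (map f zs) ] g (f z ∷ r)
      ≡⟨ cong (g (f x ∷ f z ∷ map f zs) +_) (∑-insertions-map f x zs (g ∘ (f z ∷_))) ⟩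
    g (f x ∷ f z ∷ map f zs) + ∑[ σ ← insertions x zs ] g (f z ∷ map f σ)
      ≡⟨ ∑-insertions-∷ x z zs (g ∘ map f) ⟨
    ∑[ σ ← insertions x (z ∷ zs) ] g (map f σ) ∎
    where open ≡-Reasoning

  ∑-perms-map : {B : Set} (f : A → B) (l : List A) (g : List B → ℕ) →
    ∑ (perms (map f l)) g ≡ ∑[ σ ← perms l ] g (map f σ)
  ∑-perms-map f [] g = refl
  ∑-perms-map f (x ∷ l) g = begin
    ∑ (perms (f x ∷ map f l)) g
      ≡⟨ ∑-concatMap (insertions (f x)) (perms (map f l)) g ⟩
    ∑[ q ← perms (map f l) ] ∑ (insertions (f x) q) g
      ≡⟨ ∑-perms-map f l _ ⟩
    ∑[ p ← perms l ] ∑ (insertions (f x) (map f p)) g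
      ≡⟨ ∑-cong (perms l) (λ p _ → ∑-insertions-map f x p g) ⟩
    ∑[ p ← perms l ] ∑[ σ ← insertions x p ] g (map f σ)
      ≡⟨ ∑-concatMap (insertions x) (perms l) (g ∘ map f) ⟨
    ∑[ σ ← perms (x ∷ l) ] g (map f σ) ∎
    where open ≡-Reasoning

  insertions-⊇ : (x : A) (p : List A) {σ : List A} → σ ∈ insertions x p → x ∷ p ⊆ σ
  insertions-⊇ x [] (here refl) y∈ = y∈
  insertions-⊇ x (z ∷ zs) (here refl) y∈ = y∈
  insertions-⊇ x (z ∷ zs) (there σ∈) y∈ with ∈-map⁻ (z ∷_) σ∈
  ... | σ′ , σ′∈ , refl with y∈
  ...   | here refl = there (insertions-⊇ x zs σ′∈ (here refl))
  ...   | there (here refl) = here refl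
  ...   | there (there y∈zs) = there (insertions-⊇ x zs σ′∈ (there y∈zs))

  perms-⊇ : (l : List A) {σ : List A} → σ ∈ perms l → l ⊆ σ
  perms-⊇ (x ∷ l) σ∈ y∈ with find (∈-concatMap⁻ (insertions x) {xs = perms l} σ∈)
  ... | p , p∈ , σ∈′ with y∈
  ...   | here refl = insertions-⊇ x p σ∈′ (here refl)
  ...   | there y∈l = insertions-⊇ x p σ∈′ (there (perms-⊇ l p∈ y∈l))

map-allFin-↭ : {n : ℕ} (π : Permutation n n) → map (π ⟨$⟩ʳ_) (allFin n) ↭ allFin n
map-allFin-↭ {n} π =
  ∼bag⇒↭ (unique∧set⇒bag (Unique.map⁺ injective (Unique.allFin⁺ n)) (Unique.allFin⁺ n)
    (λ {x} → mk⇔ (λ _ → ∈-allFin x)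
                 (λ _ → subst (_∈ map (π ⟨$⟩ʳ_) (allFin n)) (inverseʳ π)
                              (∈-map⁺ (π ⟨$⟩ʳ_) (∈-allFin (π ⟨$⟩ˡ x))))))
  where
  injective : ∀ {x y} → π ⟨$⟩ʳ x ≡ π ⟨$⟩ʳ y → x ≡ y
  injective eq = trans (sym (inverseˡ π)) (trans (cong (π ⟨$⟩ˡ_) eq) (inverseˡ π))

∑-orderings-relabel : {n : ℕ} (π : Permutation n n) (g : List (Fin n) → ℕ) →
  ∑[ σ ← orderings n ] g (map (π ⟨$⟩ʳ_) σ) ≡ ∑ (orderings n) g
∑-orderings-relabel {n} π g =
  trans (sym (∑-perms-map (π ⟨$⟩ʳ_) (allFin n) g)) (∑-perms-↭ (map-allFin-↭ π) g)

⟦_⟧ : Bool → ℕ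
⟦ true ⟧ = 1
⟦ false ⟧ = 0

⟦∧⟧+⟦not∧⟧≤1 : (a b c : Bool) → ⟦ a ∧ b ⟧ + ⟦ not a ∧ c ⟧ ≤ 1
⟦∧⟧+⟦not∧⟧≤1 true true c = s≤s z≤n
⟦∧⟧+⟦not∧⟧≤1 true false c = z≤n
⟦∧⟧+⟦not∧⟧≤1 false b true = s≤s z≤n
⟦∧⟧+⟦not∧⟧≤1 false b false = z≤n

⟦∨⟧≤⟦⟧+⟦⟧ : (a b : Bool) → ⟦ a ∨ b ⟧ ≤ ⟦ a ⟧ + ⟦ b ⟧
⟦∨⟧≤⟦⟧+⟦⟧ true b = s≤s z≤n
⟦∨⟧≤⟦⟧+⟦⟧ false b = ≤-refl

⟦∧not⟧+⟦not∧⟧≡⟦xor⟧ : (a b : Bool) →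
                      ⟦ a ∧ not b ⟧ + ⟦ not a ∧ b ⟧ ≡ ⟦ a xor b ⟧
⟦∧not⟧+⟦not∧⟧≡⟦xor⟧ true true = refl
⟦∧not⟧+⟦not∧⟧≡⟦xor⟧ true false = refl
⟦∧not⟧+⟦not∧⟧≡⟦xor⟧ false b = refl

does-≟-sym : {A : Set} (_≟_ : DecidableEquality A) (x y : A) → does (x ≟ y) ≡ does (y ≟ x)
does-≟-sym _≟_ x y with x ≟ y | y ≟ x
... | yes _ | yes _ = refl
... | no _ | no _ = refl
... | yes x≡y | no y≢x = contradiction (sym x≡y) y≢x
... | no x≢y | yes y≡x = contradiction (sym y≡x) x≢y

exactlyTwo : Bool → Bool → Bool → Bool
exactlyTwo true true c = not c
exactlyTwo true false c = c
exactlyTwo false b c = b ∧ c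

exactlyTwo-swap₁₂ : (a b c : Bool) → exactlyTwo a b c ≡ exactlyTwo b a c
exactlyTwo-swap₁₂ true true c = refl
exactlyTwo-swap₁₂ true false c = refl
exactlyTwo-swap₁₂ false true c = refl
exactlyTwo-swap₁₂ false false c = refl

exactlyTwo-swap₂₃ : (a b c : Bool) → exactlyTwo a b c ≡ exactlyTwo a c b
exactlyTwo-swap₂₃ true true true = refl
exactlyTwo-swap₂₃ true true false = refl
exactlyTwo-swap₂₃ true false true = refl
exactlyTwo-swap₂₃ true false false = refl
exactlyTwo-swap₂₃ false b c = ∧-comm b c

sameCluster-sym : (p q : Maybe ℕ) → sameCluster p q ≡ sameCluster q p
sameCluster-sym (just a) (just b) = does-≟-sym ℕ._≟_ a b
sameCluster-sym (just a) nothing = refl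
sameCluster-sym nothing (just b) = refl
sameCluster-sym nothing nothing = refl

sameCluster-trans : (p q r : Maybe ℕ) →
  sameCluster p q ≡ true → sameCluster q r ≡ true → sameCluster p r ≡ true
sameCluster-trans (just a) (just b) (just c) p≈q q≈r
  with refl ← ≡ᵇ⇒≡ a b (subst T (sym p≈q) _)
     | refl ← ≡ᵇ⇒≡ b c (subst T (sym q≈r) _) = q≈r
sameCluster-trans nothing nothing nothing _ _ = refl

-- A pivot labels the nodes it touches with the current counter, all later labels are larger.
labels-≡ᵇ : ∀ clus (py pz : Bool) a b → (py ∨ pz) ≡ true →
  (if py then a ≡ clus else clus < a) → (if pz then b ≡ clus else clus < b) →
  (a ≡ᵇ b) ≡ (py ∧ pz)
labels-≡ᵇ clus true true a b _ refl refl = dec-true (clus ℕ.≟ clus) refl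
labels-≡ᵇ clus true false a b _ refl clus<b = dec-false (clus ℕ.≟ b) (<⇒≢ clus<b)
labels-≡ᵇ clus false true a b _ clus<a refl = dec-false (a ℕ.≟ clus) (>⇒≢ clus<a)

length-filterᵇ : {A : Set} (p : A → Bool) (xs : List A) →
  length (filterᵇ p xs) ≡ ∑[ x ← xs ] ⟦ p x ⟧
length-filterᵇ p [] = refl
length-filterᵇ p (x ∷ xs) with p x
... | true = cong suc (length-filterᵇ p xs)
... | false = length-filterᵇ p xs

module _ {n : ℕ} where

  before : Fin n → Fin n → Bool
  before i j = toℕ i <ᵇ toℕ j

  before-true : (i j : Fin n) → toℕ i < toℕ j → before i j ≡ true
  before-true i j i<j = dec-true (toℕ i ℕ.<? toℕ j) i<j

  before-false : (i j : Fin n) → ¬ toℕ i < toℕ j → before i j ≡ false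
  before-false i j i≮j = dec-false (toℕ i ℕ.<? toℕ j) i≮j

  countPairs-∑ : (r : Fin n → Fin n → Bool) →
    countPairs r ≡ ∑[ i ← allFin n ] ∑[ j ← allFin n ] ⟦ before i j ∧ r i j ⟧
  countPairs-∑ r = trans (length-filterᵇ _ (pairs n))
    (trans (∑-concatMap _ (allFin n) _)
           (∑-cong (allFin n) (λ i _ → trans (∑-concatMap _ (allFin n) _)
                                             (∑-cong (allFin n) (λ j _ → pair i j)))))
    where
    pair : ∀ i j → ∑[ p ← (if before i j then [ (i , j) ] else []) ] ⟦ r (proj₁ p) (proj₂ p) ⟧
                   ≡ ⟦ before i j ∧ r i j ⟧
    pair i j with before i j
    ... | true = +-identityʳ _
    ... | false = refl

  ⟦⟧-split : (r : Fin n → Fin n → Bool) →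
    (∀ i j → r i j ≡ r j i) → (∀ i → r i i ≡ false) →
    ∀ i j → ⟦ r i j ⟧ ≡ ⟦ before i j ∧ r i j ⟧ + ⟦ before j i ∧ r j i ⟧
  ⟦⟧-split r r-sym r-irrefl i j with <-cmp (toℕ i) (toℕ j)
  ... | tri< i<j _ j≮i rewrite before-true i j i<j | before-false j i j≮i = sym (+-identityʳ _)
  ... | tri≈ _ i≡j _ with refl ← toℕ-injective i≡j
    rewrite r-irrefl i | ∧-zeroʳ (before i i) = refl
  ... | tri> i≮j _ j<i rewrite before-false i j i≮j | before-true j i j<i | r-sym j i = refl

  twice-countPairs : (r : Fin n → Fin n → Bool) →
    (∀ i j → r i j ≡ r j i) → (∀ i → r i i ≡ false) →
    2 * countPairs r ≡ ∑[ i ← allFin n ] ∑[ j ← allFin n ] ⟦ r i j ⟧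
  twice-countPairs r r-sym r-irrefl = begin
    2 * countPairs r
      ≡⟨ cong (2 *_) (countPairs-∑ r) ⟩
    X + (X + 0)
      ≡⟨ cong (X +_) (trans (+-identityʳ X) (∑-comm (allFin n) (allFin n) _)) ⟩
    X + ∑[ i ← allFin n ] ∑[ j ← allFin n ] ⟦ before j i ∧ r j i ⟧
      ≡⟨ ∑-+ (allFin n) _ _ ⟨
    ∑[ i ← allFin n ] (∑[ j ← allFin n ] ⟦ before i j ∧ r i j ⟧
                       + ∑[ j ← allFin n ] ⟦ before j i ∧ r j i ⟧)
      ≡⟨ ∑-cong (allFin n) (λ i _ → trans (sym (∑-+ (allFin n) _ _))
                              (∑-cong (allFin n) (λ j _ → sym (⟦⟧-split r r-sym r-irrefl i j)))) ⟩
    ∑[ i ← allFin n ] ∑[ j ← allFin n ] ⟦ r i j ⟧ ∎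
    where
    open ≡-Reasoning
    X = ∑[ i ← allFin n ] ∑[ j ← allFin n ] ⟦ before i j ∧ r i j ⟧

-- Runs of Pivot

module _ {n : ℕ} (G : Graph n) where

  V : List (Fin n)
  V = allFin n

  State : Set
  State = (Fin n → Maybe ℕ) × ℕ

  s₀ : State
  s₀ = ((λ _ → nothing) , 1)

  unclustered : State → Fin n → Bool
  unclustered s x = isNothing (proj₁ s x)

  touches : Fin n → Fin n → Bool
  touches v x = does (x ≟F v) ∨ adj G v x

  assign : (Fin n → Maybe ℕ) → ℕ → Fin n → Fin n → Maybe ℕ
  assign c clus v x = if touches v x ∧ isNothing (c x) then just clus else c x

  touches-self : (v : Fin n) → touches v v ≡ true
  touches-self v rewrite dec-true (v ≟F v) refl = refl

  ¬touches⇒≢ : (v x : Fin n) → touches v x ≡ false → ¬ x ≡ v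
  ¬touches⇒≢ v .v ¬vv refl with () ← trans (sym (touches-self v)) ¬vv

  step-clustered : ∀ s v {m} → proj₁ s v ≡ just m → pivotStep G v s ≡ s
  step-clustered s v sv rewrite sv = refl

  step-unclustered : ∀ c clus v → c v ≡ nothing →
                     pivotStep G v (c , clus) ≡ (assign c clus v , suc clus)
  step-unclustered c clus v cv rewrite cv = refl

  assign-clustered : ∀ c clus v x {m} → c x ≡ just m → assign c clus v x ≡ just m
  assign-clustered c clus v x cx rewrite cx | ∧-zeroʳ (touches v x) = refl

  assign-touched : ∀ c clus v x → c x ≡ nothing → touches v x ≡ true →
                   assign c clus v x ≡ just clus
  assign-touched c clus v x cx t rewrite cx | t = refl

  assign-untouched : ∀ c clus v x → c x ≡ nothing → touches v x ≡ false →
                     assign c clus v x ≡ nothing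
  assign-untouched c clus v x cx t rewrite cx | t = refl

  assign-label : ∀ c clus v x → c x ≡ nothing →
                 assign c clus v x ≡ nothing ⊎ assign c clus v x ≡ just clus
  assign-label c clus v x cx rewrite cx with touches v x
  ... | true = inj₂ refl
  ... | false = inj₁ refl

  step-keeps-label : ∀ s v x {m} → proj₁ s x ≡ just m → proj₁ (pivotStep G v s) x ≡ just m
  step-keeps-label (c , clus) v x cx with c v
  ... | just _ = cx
  ... | nothing = assign-clustered c clus v x cx

  run-keeps-label : ∀ vs s x {m} → proj₁ s x ≡ just m → proj₁ (pivotRun G vs s) x ≡ just m
  run-keeps-label [] s x sx = sx
  run-keeps-label (v ∷ vs) s x sx =
    run-keeps-label vs (pivotStep G v s) x (step-keeps-label s v x sx)

  step-keeps-clustered : ∀ s v x → unclustered s x ≡ false →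
                         unclustered (pivotStep G v s) x ≡ false
  step-keeps-clustered s v x sx with proj₁ s x in eq | sx
  ... | just m | _ rewrite step-keeps-label s v x eq = refl

  step-clusters-pivot : ∀ s v → unclustered (pivotStep G v s) v ≡ false
  step-clusters-pivot (c , clus) v with c v in cv
  ... | just _ rewrite cv = refl
  ... | nothing = cong isNothing (assign-touched c clus v v cv (touches-self v))

  step-counter-mono : ∀ s v → proj₂ s ≤ proj₂ (pivotStep G v s)
  step-counter-mono (c , clus) v with c v
  ... | just _ = ≤-refl
  ... | nothing = n≤1+n clus

  step-label : ∀ s v x → proj₁ s x ≡ nothing →
    proj₁ (pivotStep G v s) x ≡ nothing ⊎ proj₁ (pivotStep G v s) x ≡ just (proj₂ s)
  step-label (c , clus) v x cx with c v
  ... | just _ = inj₁ cx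
  ... | nothing = assign-label c clus v x cx

  run-label : ∀ vs s x → proj₁ s x ≡ nothing → x ∈ vs →
    ∃ λ m → proj₁ (pivotRun G vs s) x ≡ just m × proj₂ s ≤ m
  run-label (v ∷ vs) s x sx x∈ with step-label s v x sx
  ... | inj₂ labelled = proj₂ s , run-keeps-label vs (pivotStep G v s) x labelled , ≤-refl
  ... | inj₁ still with x∈
  ...   | here refl with () ← trans (cong isNothing (sym still)) (step-clusters-pivot s v)
  ...   | there x∈vs with run-label vs (pivotStep G v s) x still x∈vs
  ...     | m , label , counter≤m = m , label , ≤-trans (step-counter-mono s v) counter≤m

  allUnclustered : State → Fin n → Fin n → Fin n → Bool
  allUnclustered s k y z = unclustered s k ∧ unclustered s y ∧ unclustered s z

  allUnclustered-false : ∀ s k y z w → unclustered s w ≡ false → w ≡ k ⊎ w ≡ y ⊎ w ≡ z →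
                         allUnclustered s k y z ≡ false
  allUnclustered-false s k y z w sw (inj₁ refl) rewrite sw = refl
  allUnclustered-false s k y z w sw (inj₂ (inj₁ refl)) rewrite sw = ∧-zeroʳ (unclustered s k)
  allUnclustered-false s k y z w sw (inj₂ (inj₂ refl))
    rewrite sw | ∧-zeroʳ (unclustered s y) = ∧-zeroʳ (unclustered s k)

  -- k becomes a pivot before any of k, y, z is clustered.
  hitsFirst : List (Fin n) → State → Fin n → Fin n → Fin n → Bool
  hitsFirst []       s k y z = false
  hitsFirst (v ∷ vs) s k y z =
    if does (v ≟F k) then allUnclustered s k y z else hitsFirst vs (pivotStep G v s) k y z

  hitsFirst-clustered : ∀ vs s k y z w → unclustered s w ≡ false → w ≡ k ⊎ w ≡ y ⊎ w ≡ z →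
                        hitsFirst vs s k y z ≡ false
  hitsFirst-clustered [] s k y z w sw w∈ = refl
  hitsFirst-clustered (v ∷ vs) s k y z w sw w∈ with does (v ≟F k)
  ... | true = allUnclustered-false s k y z w sw w∈
  ... | false =
    hitsFirst-clustered vs (pivotStep G v s) k y z w (step-keeps-clustered s v w sw) w∈

  hitsFirst-swap₂₃ : ∀ vs s k y z → hitsFirst vs s k y z ≡ hitsFirst vs s k z y
  hitsFirst-swap₂₃ [] s k y z = refl
  hitsFirst-swap₂₃ (v ∷ vs) s k y z with does (v ≟F k)
  ... | true = cong (unclustered s k ∧_) (∧-comm (unclustered s y) (unclustered s z))
  ... | false = hitsFirst-swap₂₃ vs (pivotStep G v s) k y z

  -- Matching on v ≟F k and v ≟F y also evaluates Transposition.transpose k y v.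
  hitsFirst-transpose : ∀ vs s k y z →
    hitsFirst vs s k y z ≡ hitsFirst (map (Transposition.transpose k y) vs) s y k z
  hitsFirst-transpose [] s k y z = refl
  hitsFirst-transpose (v ∷ vs) s k y z with v ≟F k
  ... | yes refl rewrite dec-true (y ≟F y) refl =
    ∧-x∙yz≈y∙xz (unclustered s v) (unclustered s y) (unclustered s z)
  ... | no v≢k with v ≟F y
  ...   | yes refl rewrite dec-false (k ≟F v) (v≢k ∘ sym) =
    trans (hitsFirst-clustered vs (pivotStep G v s) k v z v
                               (step-clusters-pivot s v) (inj₂ (inj₁ refl)))
          (sym (hitsFirst-clustered (map (Transposition.transpose k v) vs) (pivotStep G k s) v k z k
                                    (step-clusters-pivot s k) (inj₂ (inj₁ refl))))
  ...   | no v≢y rewrite dec-false (v ≟F y) v≢y = hitsFirst-transpose vs (pivotStep G v s) k y z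

  -- Charging disagreements to open wedges

  distinct : Fin n → Fin n → Bool
  distinct i j = not (does (i ≟F j))

  distinct-sym : (i j : Fin n) → distinct i j ≡ distinct j i
  distinct-sym i j = cong not (does-≟-sym _≟F_ i j)

  openWedge : Fin n → Fin n → Fin n → Bool
  openWedge k y z =
    distinct k y ∧ distinct k z ∧ distinct y z ∧ exactlyTwo (adj G k y) (adj G k z) (adj G y z)

  openWedge-swap₂₃ : ∀ k y z → openWedge k y z ≡ openWedge k z y
  openWedge-swap₂₃ k y z = trans (∧-x∙yz≈y∙xz (distinct k y) (distinct k z) _)
    (cong₂ (λ d t → distinct k z ∧ distinct k y ∧ d ∧ t) (distinct-sym y z)
           (trans (exactlyTwo-swap₁₂ (adj G k y) (adj G k z) _)
                  (cong (exactlyTwo (adj G k z) (adj G k y)) (Graph.sym G y z))))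

  openWedge-swap₁₂ : ∀ k y z → openWedge k y z ≡ openWedge y k z
  openWedge-swap₁₂ k y z =
    cong₂ _∧_ (distinct-sym k y) (trans (∧-x∙yz≈y∙xz (distinct k z) (distinct y z) _)
      (cong (λ t → distinct y z ∧ distinct k z ∧ t)
            (trans (exactlyTwo-swap₂₃ (adj G k y) (adj G k z) _)
                   (cong (λ a → exactlyTwo a (adj G y z) (adj G k z)) (Graph.sym G k y)))))

  openWedge-diagonal : ∀ k y → openWedge k y y ≡ false
  openWedge-diagonal k y rewrite dec-true (y ≟F y) refl | ∧-zeroʳ (distinct k y) =
    ∧-zeroʳ (distinct k y)

  openWedge-far : ∀ v y z → touches v y ≡ false → touches v z ≡ false → openWedge v y z ≡ false
  openWedge-far v y z vy vz
    rewrite ∨-conicalʳ (does (y ≟F v)) (adj G v y) vy | ∨-conicalʳ (does (z ≟F v)) (adj G v z) vz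
          | ∧-zeroʳ (distinct y z) | ∧-zeroʳ (distinct v z) = ∧-zeroʳ (distinct v y)

  disagrees : (Fin n → Maybe ℕ) → Fin n → Fin n → Bool
  disagrees c y z = adj G y z xor sameCluster (c y) (c z)

  charge : List (Fin n) → State → Fin n → Fin n → Fin n → ℕ
  charge vs s k y z = ⟦ hitsFirst vs s k y z ∧ openWedge k y z ⟧

  xor-touches≡openWedge : ∀ v y z → ¬ y ≡ z → (touches v y ∨ touches v z) ≡ true →
                          adj G y z xor (touches v y ∧ touches v z) ≡ openWedge v y z
  xor-touches≡openWedge v y z y≢z t with y ≟F v
  ... | yes refl rewrite dec-false (z ≟F y) (y≢z ∘ sym) | dec-true (y ≟F y) refl =
    xor-same (adj G y z)
  ... | no y≢v with z ≟F v
  ...   | yes refl rewrite dec-false (y ≟F z) y≢z | dec-true (z ≟F z) refl | Graph.sym G y z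
                         | ∧-identityʳ (adj G z y) | ∧-zeroʳ (distinct z y) = xor-same (adj G z y)
  ...   | no z≢v rewrite dec-false (v ≟F y) (y≢v ∘ sym) | dec-false (v ≟F z) (z≢v ∘ sym)
                       | dec-false (y ≟F z) y≢z = neighbours (adj G v y) (adj G v z) (adj G y z) t
    where
    neighbours : ∀ a b c → (a ∨ b) ≡ true → c xor (a ∧ b) ≡ exactlyTwo a b c
    neighbours true true true _ = refl
    neighbours true true false _ = refl
    neighbours true false true _ = refl
    neighbours true false false _ = refl
    neighbours false true true _ = refl
    neighbours false true false _ = refl

  hitsFirst-∷-clustered : ∀ vs s v k y z {m} → proj₁ s v ≡ just m →
                          hitsFirst (v ∷ vs) s k y z ≡ hitsFirst vs s k y z
  hitsFirst-∷-clustered vs s v k y z sv with v ≟F k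
  ... | yes refl = trans (allUnclustered-false s v y z v (cong isNothing sv) (inj₁ refl))
                         (sym (hitsFirst-clustered vs s v y z v (cong isNothing sv) (inj₁ refl)))
  ... | no _ rewrite step-clustered s v sv = refl

  charge-∷-far : ∀ vs c clus v k y z →
    c v ≡ nothing → touches v y ≡ false → touches v z ≡ false →
    charge (v ∷ vs) (c , clus) k y z ≡ charge vs (assign c clus v , suc clus) k y z
  charge-∷-far vs c clus v k y z cv vy vz rewrite step-unclustered c clus v cv with v ≟F k
  ... | yes refl rewrite openWedge-far v y z vy vz | ∧-zeroʳ (allUnclustered (c , clus) v y z)
                       | ∧-zeroʳ (hitsFirst vs (assign c clus v , suc clus) v y z) = refl
  ... | no _ = refl

  ∑-charge-pivot : ∀ vs c clus v y z → c v ≡ nothing → c y ≡ nothing → c z ≡ nothing →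
    (touches v y ∨ touches v z) ≡ true →
    ∑[ k ← V ] charge (v ∷ vs) (c , clus) k y z ≡ ⟦ openWedge v y z ⟧
  ∑-charge-pivot vs c clus v y z cv cy cz t =
    trans (∑-eq-single V v _ (Unique.allFin⁺ n) (∈-allFin v) others) at-pivot
    where
    s′ : State
    s′ = (assign c clus v , suc clus)
    touched : ∃ λ w → unclustered s′ w ≡ false × (w ≡ y ⊎ w ≡ z)
    touched with touches v y in ty
    ... | true = y , cong isNothing (assign-touched c clus v y cy ty) , inj₁ refl
    ... | false = z , cong isNothing (assign-touched c clus v z cz t) , inj₂ refl
    others : ∀ k → ¬ k ≡ v → charge (v ∷ vs) (c , clus) k y z ≡ 0
    others k k≢v with w , sw , w∈ ← touched
      rewrite dec-false (v ≟F k) (k≢v ∘ sym) | step-unclustered c clus v cv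
            | hitsFirst-clustered vs s′ k y z w sw (inj₂ w∈) = refl
    at-pivot : charge (v ∷ vs) (c , clus) v y z ≡ ⟦ openWedge v y z ⟧
    at-pivot rewrite dec-true (v ≟F v) refl | cv | cy | cz = refl

  final-label : ∀ vs c clus v x → c x ≡ nothing → x ∈ v ∷ vs →
    ∃ λ m → proj₁ (pivotRun G vs (assign c clus v , suc clus)) x ≡ just m
          × (if touches v x then m ≡ clus else clus < m)
  final-label vs c clus v x cx x∈ with touches v x in t
  ... | true = clus , run-keeps-label vs _ x (assign-touched c clus v x cx t) , refl
  ... | false = run-label vs _ x (assign-untouched c clus v x cx t) (Any.tail (¬touches⇒≢ v x t) x∈)

  disagrees-after-pivot : ∀ vs c clus v y z → c y ≡ nothing → c z ≡ nothing →
    y ∈ v ∷ vs → z ∈ v ∷ vs → ¬ y ≡ z → (touches v y ∨ touches v z) ≡ true →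
    disagrees (proj₁ (pivotRun G vs (assign c clus v , suc clus))) y z ≡ openWedge v y z
  disagrees-after-pivot vs c clus v y z cy cz y∈ z∈ y≢z t
    with final-label vs c clus v y cy y∈ | final-label vs c clus v z cz z∈
  ... | a , ya , a~ | b , zb , b~
    rewrite ya | zb | labels-≡ᵇ clus (touches v y) (touches v z) a b t a~ b~ =
      xor-touches≡openWedge v y z y≢z t

  -- The first pivot v touching {y,z} is the only k that can be charged; it is charged iff
  -- {v,y,z} is an open wedge, which is exactly when the pair ends up a mistake.
  ⟦disagrees⟧≡∑-charge : ∀ vs s y z → ¬ y ≡ z →
    proj₁ s y ≡ nothing → proj₁ s z ≡ nothing → y ∈ vs → z ∈ vs →
    ⟦ disagrees (proj₁ (pivotRun G vs s)) y z ⟧ ≡ ∑[ k ← V ] charge vs s k y z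
  ⟦disagrees⟧≡∑-charge (v ∷ vs) (c , clus) y z y≢z cy cz y∈ z∈ = by-status-of-v (c v) refl
    where
    disagreement-after : State → ℕ
    disagreement-after s = ⟦ disagrees (proj₁ (pivotRun G vs s)) y z ⟧

    charged : State → ℕ
    charged s = ∑[ k ← V ] charge (v ∷ vs) s k y z

    v-pivots : c v ≡ nothing → disagreement-after (assign c clus v , suc clus) ≡ charged (c , clus)
    v-pivots cv with touches v y ∨ touches v z in t
    ... | true = trans (cong ⟦_⟧ (disagrees-after-pivot vs c clus v y z cy cz y∈ z∈ y≢z t))
                       (sym (∑-charge-pivot vs c clus v y z cv cy cz t))
    ... | false = trans
      (⟦disagrees⟧≡∑-charge vs (assign c clus v , suc clus) y z y≢z
         (assign-untouched c clus v y cy vy) (assign-untouched c clus v z cz vz)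
         (Any.tail (¬touches⇒≢ v y vy) y∈) (Any.tail (¬touches⇒≢ v z vz) z∈))
      (∑-cong V (λ k _ → sym (charge-∷-far vs c clus v k y z cv vy vz)))
      where
      vy = ∨-conicalˡ (touches v y) (touches v z) t
      vz = ∨-conicalʳ (touches v y) (touches v z) t

    by-status-of-v : (m : Maybe ℕ) → c v ≡ m →
                     disagreement-after (pivotStep G v (c , clus)) ≡ charged (c , clus)
    by-status-of-v (just _) cv = trans (cong disagreement-after (step-clustered (c , clus) v cv))
      (trans (⟦disagrees⟧≡∑-charge vs (c , clus) y z y≢z cy cz
                                    (Any.tail (≢v cy) y∈) (Any.tail (≢v cz) z∈))
             (∑-cong V (λ k _ → cong (λ b → ⟦ b ∧ openWedge k y z ⟧)
                                     (sym (hitsFirst-∷-clustered vs (c , clus) v k y z cv)))))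
      where
      ≢v : ∀ {x} → c x ≡ nothing → ¬ x ≡ v
      ≢v cx refl with () ← trans (sym cx) cv
    by-status-of-v nothing cv =
      trans (cong disagreement-after (step-unclustered c clus v cv)) (v-pivots cv)

  pivot-isSTC+ : (σ : List (Fin n)) → IsSTC+ G (pivotLabeling G σ)
  pivot-isSTC+ σ = record
    { weak-sym   = λ i j → cong₂ (λ a b → a ∧ not b) (Graph.sym G i j) (sameCluster-sym (c i) (c j))
    ; new-sym    = λ i j → cong₂ (λ a b → not a ∧ b) (Graph.sym G i j)
                                 (cong₂ _∧_ (distinct-sym i j) (sameCluster-sym (c i) (c j)))
    ; weak⊆E     = λ i j e → ∧-conicalˡ _ _ e
    ; new⊆nonE   = λ i j e → trans (sym (not-involutive (adj G i j))) (cong not (∧-conicalˡ _ _ e))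
    ; new-irrefl = new-irrefl
    ; wedge      = wedge
    }
    where
    c = pivot G σ
    new-irrefl : ∀ i → (not (adj G i i) ∧ distinct i i ∧ sameCluster (c i) (c i)) ≡ false
    new-irrefl i rewrite dec-true (i ≟F i) refl = ∧-zeroʳ _
    wedge : ∀ u v w → ¬ v ≡ w → adj G u v ≡ true → adj G u w ≡ true → adj G v w ≡ false →
      ((adj G u v ∧ not (sameCluster (c u) (c v))) ∨ (adj G u w ∧ not (sameCluster (c u) (c w)))
        ∨ (not (adj G v w) ∧ distinct v w ∧ sameCluster (c v) (c w))) ≡ true
    wedge u v w v≢w uv uw vw rewrite uv | uw | vw | dec-false (v ≟F w) v≢w
      with sameCluster (c u) (c v) in u~v | sameCluster (c u) (c w) in u~w
    ... | false | _ = refl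
    ... | true | false = refl
    ... | true | true = sameCluster-trans (c v) (c u) (c w) (trans (sameCluster-sym (c v) (c u)) u~v) u~w

  pairCost : Labeling n → Fin n → Fin n → ℕ
  pairCost L i j = ⟦ weak L i j ⟧ + ⟦ new L i j ⟧

  twice-cost : (L : Labeling n) → IsSTC+ G L → 2 * cost L ≡ ∑[ i ← V ] ∑[ j ← V ] pairCost L i j
  twice-cost L stc = begin
    2 * (countPairs (weak L) + countPairs (new L))
      ≡⟨ *-distribˡ-+ 2 (countPairs (weak L)) _ ⟩
    2 * countPairs (weak L) + 2 * countPairs (new L)
      ≡⟨ cong₂ _+_ (twice-countPairs (weak L) (IsSTC+.weak-sym stc) weak-irrefl)
                   (twice-countPairs (new L) (IsSTC+.new-sym stc) (IsSTC+.new-irrefl stc)) ⟩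
    ∑[ i ← V ] ∑[ j ← V ] ⟦ weak L i j ⟧ + ∑[ i ← V ] ∑[ j ← V ] ⟦ new L i j ⟧
      ≡⟨ ∑-+ V _ _ ⟨
    ∑[ i ← V ] (∑[ j ← V ] ⟦ weak L i j ⟧ + ∑[ j ← V ] ⟦ new L i j ⟧)
      ≡⟨ ∑-cong V (λ i _ → ∑-+ V _ _) ⟨
    ∑[ i ← V ] ∑[ j ← V ] pairCost L i j ∎
    where
    open ≡-Reasoning
    weak-irrefl : ∀ i → weak L i i ≡ false
    weak-irrefl i with weak L i i in e
    ... | false = refl
    ... | true with () ← trans (sym (IsSTC+.weak⊆E stc i i e)) (Graph.irrefl G i)

  pivot-pairCost≤1 : (σ : List (Fin n)) (y z : Fin n) → pairCost (pivotLabeling G σ) y z ≤ 1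
  pivot-pairCost≤1 σ y z = ⟦∧⟧+⟦not∧⟧≤1 (adj G y z) _ _

  pivot-pairCost≡⟦disagrees⟧ : (σ : List (Fin n)) (y z : Fin n) → ¬ y ≡ z →
    pairCost (pivotLabeling G σ) y z ≡ ⟦ disagrees (pivot G σ) y z ⟧
  pivot-pairCost≡⟦disagrees⟧ σ y z y≢z rewrite dec-false (y ≟F z) y≢z =
    ⟦∧not⟧+⟦not∧⟧≡⟦xor⟧ (adj G y z) _

  pivot-pairCost≡∑-charge : (σ : List (Fin n)) → σ ∈ orderings n → (y z : Fin n) →
    pairCost (pivotLabeling G σ) y z ≡ ∑[ k ← V ] charge σ s₀ k y z
  pivot-pairCost≡∑-charge σ σ∈ y z = by-cases (y ≟F z)
    where
    by-cases : Dec (y ≡ z) →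
      pairCost (pivotLabeling G σ) y z ≡ ∑[ k ← V ] charge σ s₀ k y z
    by-cases (yes refl) = trans diagonal (sym (∑-zero V (λ k _ → cong ⟦_⟧
      (trans (cong (hitsFirst σ s₀ k y y ∧_) (openWedge-diagonal k y))
             (∧-zeroʳ (hitsFirst σ s₀ k y y))))))
      where
      diagonal : pairCost (pivotLabeling G σ) y y ≡ 0
      diagonal rewrite Graph.irrefl G y | dec-true (y ≟F y) refl = refl
    by-cases (no y≢z) = trans (pivot-pairCost≡⟦disagrees⟧ σ y z y≢z)
      (⟦disagrees⟧≡∑-charge σ s₀ y z y≢z refl refl
                            (perms-⊇ V σ∈ (∈-allFin y)) (perms-⊇ V σ∈ (∈-allFin z)))

  -- The charging argument

  wedgeHits : Fin n → Fin n → Fin n → ℕ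
  wedgeHits k y z = ∑[ σ ← orderings n ] charge σ s₀ k y z

  wedgeHits-swap₂₃ : ∀ k y z → wedgeHits k y z ≡ wedgeHits k z y
  wedgeHits-swap₂₃ k y z = ∑-cong (orderings n) (λ σ _ →
    cong₂ (λ h w → ⟦ h ∧ w ⟧) (hitsFirst-swap₂₃ σ s₀ k y z) (openWedge-swap₂₃ k y z))

  wedgeHits-swap₁₂ : ∀ k y z → wedgeHits k y z ≡ wedgeHits y k z
  wedgeHits-swap₁₂ k y z = trans
    (∑-cong (orderings n) (λ σ _ →
       cong₂ (λ h w → ⟦ h ∧ w ⟧) (hitsFirst-transpose σ s₀ k y z) (openWedge-swap₁₂ k y z)))
    (∑-orderings-relabel (transpose k y) (λ σ → charge σ s₀ y k z))

  wedgeHits-nonWedge : ∀ k y z → openWedge k y z ≡ false → wedgeHits k y z ≡ 0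
  wedgeHits-nonWedge k y z w = ∑-zero (orderings n) (λ σ _ →
    cong ⟦_⟧ (trans (cong (hitsFirst σ s₀ k y z ∧_) w) (∧-zeroʳ (hitsFirst σ s₀ k y z))))

  ∑-wedgeHits≤ : ∀ y z → ∑[ k ← V ] wedgeHits k y z ≤ length (orderings n)
  ∑-wedgeHits≤ y z = begin
    ∑[ k ← V ] wedgeHits k y z
      ≡⟨ ∑-comm V (orderings n) _ ⟩
    ∑[ σ ← orderings n ] ∑[ k ← V ] charge σ s₀ k y z
      ≡⟨ ∑-cong (orderings n) (λ σ σ∈ → pivot-pairCost≡∑-charge σ σ∈ y z) ⟨
    ∑[ σ ← orderings n ] pairCost (pivotLabeling G σ) y z
      ≤⟨ ∑-mono (orderings n) (λ σ → pivot-pairCost≤1 σ y z) ⟩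
    ∑[ _ ← orderings n ] 1
      ≡⟨ trans (∑-const (orderings n) 1) (*-identityʳ _) ⟩
    length (orderings n) ∎
    where open ≤-Reasoning

  twice-totalPivotCost : 2 * totalPivotCost G ≡ ∑³ V (λ y z k → wedgeHits k y z)
  twice-totalPivotCost = begin
    2 * totalPivotCost G
      ≡⟨ ∑-*ˡ (orderings n) 2 _ ⟨
    ∑[ σ ← orderings n ] (2 * cost (pivotLabeling G σ))
      ≡⟨ ∑-cong (orderings n) (λ σ σ∈ → trans (twice-cost _ (pivot-isSTC+ σ))
           (∑-cong V (λ y _ → ∑-cong V (λ z _ → pivot-pairCost≡∑-charge σ σ∈ y z)))) ⟩
    ∑[ σ ← orderings n ] ∑[ y ← V ] ∑[ z ← V ] ∑[ k ← V ] charge σ s₀ k y z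
      ≡⟨ ∑-comm (orderings n) V _ ⟩
    ∑[ y ← V ] ∑[ σ ← orderings n ] ∑[ z ← V ] ∑[ k ← V ] charge σ s₀ k y z
      ≡⟨ ∑-cong V (λ y _ → trans (∑-comm (orderings n) V _)
                                 (∑-cong V (λ z _ → ∑-comm (orderings n) V _))) ⟩
    ∑³ V (λ y z k → wedgeHits k y z) ∎
    where open ≡-Reasoning

  module _ (L : Labeling n) (stc : IsSTC+ G L) where

    wedgeCost : Fin n → Fin n → Fin n → ℕ
    wedgeCost k y z = pairCost L y z + pairCost L k y + pairCost L k z

    pairCost-sym : ∀ p q → pairCost L p q ≡ pairCost L q p
    pairCost-sym p q =
      cong₂ (λ w m → ⟦ w ⟧ + ⟦ m ⟧) (IsSTC+.weak-sym stc p q) (IsSTC+.new-sym stc p q)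

    center-covered : ∀ u v w → (weak L u v ∨ weak L u w ∨ new L v w) ≡ true →
                     1 ≤ pairCost L u v + pairCost L u w + pairCost L v w
    center-covered u v w covered = begin
      1
        ≡⟨ cong ⟦_⟧ covered ⟨
      ⟦ weak L u v ∨ weak L u w ∨ new L v w ⟧
        ≤⟨ ⟦∨⟧≤⟦⟧+⟦⟧ (weak L u v) (weak L u w ∨ new L v w) ⟩
      ⟦ weak L u v ⟧ + ⟦ weak L u w ∨ new L v w ⟧
        ≤⟨ +-monoʳ-≤ ⟦ weak L u v ⟧ (⟦∨⟧≤⟦⟧+⟦⟧ (weak L u w) (new L v w)) ⟩
      ⟦ weak L u v ⟧ + (⟦ weak L u w ⟧ + ⟦ new L v w ⟧)
        ≤⟨ +-mono-≤ (m≤m+n ⟦ weak L u v ⟧ ⟦ new L u v ⟧)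
                    (+-mono-≤ (m≤m+n ⟦ weak L u w ⟧ ⟦ new L u w ⟧)
                              (m≤n+m ⟦ new L v w ⟧ ⟦ weak L v w ⟧)) ⟩
      pairCost L u v + (pairCost L u w + pairCost L v w)
        ≡⟨ +-assoc (pairCost L u v) _ _ ⟨
      pairCost L u v + pairCost L u w + pairCost L v w ∎
      where open ≤-Reasoning

    openWedge-covered : ∀ k y z → openWedge k y z ≡ true → 1 ≤ wedgeCost k y z
    openWedge-covered k y z w = by-shape (adj G k y) (adj G k z) (adj G y z) refl refl refl two-edges
      where
      d₁ = distinct k y
      d₂ = distinct k z
      d₃ = distinct y z
      two = exactlyTwo (adj G k y) (adj G k z) (adj G y z)
      w₂ = ∧-conicalʳ d₁ (d₂ ∧ d₃ ∧ two) w
      w₃ = ∧-conicalʳ d₂ (d₃ ∧ two) w₂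
      two-edges = ∧-conicalʳ d₃ two w₃
      distinct⇒≢ : ∀ i j → distinct i j ≡ true → ¬ i ≡ j
      distinct⇒≢ i .i d refl rewrite dec-true (i ≟F i) refl with () ← d
      k≢y = distinct⇒≢ k y (∧-conicalˡ d₁ _ w)
      k≢z = distinct⇒≢ k z (∧-conicalˡ d₂ _ w₂)
      y≢z = distinct⇒≢ y z (∧-conicalˡ d₃ two w₃)
      by-shape : ∀ a b c → adj G k y ≡ a → adj G k z ≡ b → adj G y z ≡ c →
                 exactlyTwo a b c ≡ true → 1 ≤ wedgeCost k y z
      by-shape true true false ky kz yz _ =
        ≤-trans (center-covered k y z (IsSTC+.wedge stc k y z y≢z ky kz yz))
                (≤-reflexive (xy∙z≈zx∙y (pairCost L k y) (pairCost L k z) (pairCost L y z)))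
      by-shape true false true ky kz yz _ =
        ≤-trans (center-covered y k z (IsSTC+.wedge stc y k z k≢z (trans (Graph.sym G y k) ky) yz kz))
                (≤-reflexive (trans (cong (λ t → t + pairCost L y z + pairCost L k z) (pairCost-sym y k))
                                    (xy∙z≈yx∙z (pairCost L k y) (pairCost L y z) (pairCost L k z))))
      by-shape false true true ky kz yz _ =
        ≤-trans (center-covered z k y (IsSTC+.wedge stc z k y k≢y (trans (Graph.sym G z k) kz)
                                                       (trans (Graph.sym G z y) yz) ky))
                (≤-reflexive (trans (cong₂ (λ s t → s + t + pairCost L k y)
                                           (pairCost-sym z k) (pairCost-sym z y))
                                    (xy∙z≈yz∙x (pairCost L k z) (pairCost L y z) (pairCost L k y))))

    wedgeHits≤wedgeHits*wedgeCost : ∀ k y z → wedgeHits k y z ≤ wedgeHits k y z * wedgeCost k y z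
    wedgeHits≤wedgeHits*wedgeCost k y z = by-wedge (openWedge k y z) refl
      where
      by-wedge : ∀ b → openWedge k y z ≡ b → wedgeHits k y z ≤ wedgeHits k y z * wedgeCost k y z
      by-wedge true w = ≤-trans (≤-reflexive (sym (*-identityʳ _)))
                                (*-monoʳ-≤ (wedgeHits k y z) (openWedge-covered k y z w))
      by-wedge false w rewrite wedgeHits-nonWedge k y z w = z≤n

    ∑³-wedgeHits*wedgeCost : ∑³ V (λ y z k → wedgeHits k y z * wedgeCost k y z)
                             ≡ 3 * ∑³ V (λ y z k → wedgeHits k y z * pairCost L y z)
    ∑³-wedgeHits*wedgeCost = begin
      ∑³ V (λ y z k → wedgeHits k y z * wedgeCost k y z)
        ≡⟨ ∑³-cong V (λ y z k →
             trans (*-distribˡ-+ (wedgeHits k y z) (pairCost L y z + pairCost L k y) _)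
                   (cong (_+ wedgeHits k y z * pairCost L k z) (*-distribˡ-+ (wedgeHits k y z) _ _))) ⟩
      ∑³ V (λ y z k → g y z k + wedgeHits k y z * pairCost L k y + wedgeHits k y z * pairCost L k z)
        ≡⟨ trans (∑³-+ V _ _)
                 (cong (_+ ∑³ V (λ y z k → wedgeHits k y z * pairCost L k z)) (∑³-+ V _ _)) ⟩
      ∑³ V g + ∑³ V (λ y z k → wedgeHits k y z * pairCost L k y)
             + ∑³ V (λ y z k → wedgeHits k y z * pairCost L k z)
        ≡⟨ cong₂ (λ s t → ∑³ V g + s + t) rotated reversed ⟩
      ∑³ V g + ∑³ V g + ∑³ V g
        ≡⟨ solve 1 (λ x → x :+ x :+ x := con 3 :* x) refl (∑³ V g) ⟩
      3 * ∑³ V g ∎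
      where
      open ≡-Reasoning
      open +-*-Solver
      g : Fin n → Fin n → Fin n → ℕ
      g y z k = wedgeHits k y z * pairCost L y z
      rotated : ∑³ V (λ y z k → wedgeHits k y z * pairCost L k y) ≡ ∑³ V g
      rotated = trans (∑³-cong V (λ y z k → cong (_* pairCost L k y)
                                   (trans (wedgeHits-swap₂₃ k y z) (wedgeHits-swap₁₂ k z y))))
                      (∑³-rotate V g)
      reversed : ∑³ V (λ y z k → wedgeHits k y z * pairCost L k z) ≡ ∑³ V g
      reversed = trans (∑³-cong V (λ y z k → cong (_* pairCost L k z) (wedgeHits-swap₁₂ k y z)))
                       (∑³-reverse V g)

    ∑³-wedgeHits*pairCost≤ : ∑³ V (λ y z k → wedgeHits k y z * pairCost L y z)
                             ≤ length (orderings n) * (2 * cost L)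
    ∑³-wedgeHits*pairCost≤ = begin
      ∑[ y ← V ] ∑[ z ← V ] ∑[ k ← V ] (wedgeHits k y z * pairCost L y z)
        ≡⟨ ∑-cong V (λ y _ → ∑-cong V (λ z _ →
             trans (∑-cong V (λ k _ → *-comm (wedgeHits k y z) _)) (∑-*ˡ V (pairCost L y z) _))) ⟩
      ∑[ y ← V ] ∑[ z ← V ] (pairCost L y z * ∑[ k ← V ] wedgeHits k y z)
        ≤⟨ ∑-mono V (λ y → ∑-mono V (λ z →
             *-monoʳ-≤ (pairCost L y z) (∑-wedgeHits≤ y z))) ⟩
      ∑[ y ← V ] ∑[ z ← V ] (pairCost L y z * N)
        ≡⟨ ∑-cong V (λ y _ →
             trans (∑-cong V (λ z _ → *-comm (pairCost L y z) N)) (∑-*ˡ V N _)) ⟩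
      ∑[ y ← V ] (N * ∑[ z ← V ] pairCost L y z)
        ≡⟨ ∑-*ˡ V N _ ⟩
      N * ∑[ y ← V ] ∑[ z ← V ] pairCost L y z
        ≡⟨ cong (N *_) (twice-cost L stc) ⟨
      N * (2 * cost L) ∎
      where
      open ≤-Reasoning
      N = length (orderings n)

    pivot-3-approx : totalPivotCost G ≤ 3 * length (orderings n) * cost L
    pivot-3-approx = *-cancelˡ-≤ 2 (begin
      2 * totalPivotCost G
        ≡⟨ twice-totalPivotCost ⟩
      ∑³ V (λ y z k → wedgeHits k y z)
        ≤⟨ ∑³-mono V (λ y z k → wedgeHits≤wedgeHits*wedgeCost k y z) ⟩
      ∑³ V (λ y z k → wedgeHits k y z * wedgeCost k y z)
        ≡⟨ ∑³-wedgeHits*wedgeCost ⟩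
      3 * ∑³ V (λ y z k → wedgeHits k y z * pairCost L y z)
        ≤⟨ *-monoʳ-≤ 3 ∑³-wedgeHits*pairCost≤ ⟩
      3 * (length (orderings n) * (2 * cost L))
        ≡⟨ solve 2 (λ m c → con 3 :* (m :* (con 2 :* c)) := con 2 :* (con 3 :* m :* c))
                 refl (length (orderings n)) (cost L) ⟩
      2 * (3 * length (orderings n) * cost L) ∎)
      where
      open ≤-Reasoning
      open +-*-Solver

lemma1 : {n : ℕ} (G : Graph n) →
    ((σ : List (Fin n)) → σ ∈ orderings n → IsSTC+ G (pivotLabeling G σ))
    × ((L : Labeling n) → IsSTC+ G L →
       totalPivotCost G ≤ 3 * length (orderings n) * cost L)
lemma1 G = (λ σ _ → pivot-isSTC+ G σ) , (λ L stc → pivot-3-approx G L stc)
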